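{- There exist absolute constants $c_1,c_2>0$ with the following property. Let $S$ be the set of $m\in\mathbb{N}$ such that for all integers $k$ with $0\le k\le \exp(c_1\sqrt{\log m})$ and for all primes $p$, \[ \nu_p\!\left(\binom{2m}{m}\right)-\nu_p\!\left(\binom{m+k}{m}\right)\ \ge\ c_2\,\frac{\log m}{\log p}\cdot[\,p\le 2k\,]. \] Then $S$ has asymptotic density $1$.
   Context: $\nu_p$ denotes the $p$-adic valuation. $[\,p\le 2k\,]$ is the Iverson bracket: it equals $1$ if $p\le 2k$ and $0$ otherwise. $\log$ is the natural logarithm. -}

module Defs where

open import Data.Nat using (ℕ; zero; suc; _+_; _*_; _∸_; _^_; _≤_; _<_)
open import Data.Nat.DivMod using (_/_)
open import Data.Nat.Divisibility using (_∣?_)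
open import Data.Nat.Primality using (Prime)
open import Data.Nat.Combinatorics using (_C_)
open import Data.Nat.Logarithm using (⌊log₂_⌋; ⌈log₂_⌉)
open import Data.Fin using (Fin; toℕ)
open import Data.Fin.Subset using (Subset; _∈_; ∣_∣)
open import Relation.Nullary using (yes; no)
open import Data.Product using (Σ; _×_)

-- p-adic valuation ν p n : the largest e with p^e ∣ n (for p ≥ 2, n ≥ 1);
-- conventionally 0 when p < 2 or n = 0 (never used in those cases).
-- Fuel n suffices since n / p < n for n ≥ 1, p ≥ 2.
ν : ℕ → ℕ → ℕ
ν zero n = 0
ν (suc zero) n = 0
ν (suc (suc q)) n = go n n
  where
  go : ℕ → ℕ → ℕ
  go zero _ = 0
  go (suc f) zero = 0
  go (suc f) (suc n') with suc (suc q) ∣? suc n'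
  ... | yes _ = suc (go f (suc n' / suc (suc q)))
  ... | no  _ = 0

InS : ℕ → ℕ → ℕ → ℕ → ℕ → Set
InS a1 b1 a2 b2 m =
  (k : ℕ) → b1 * (⌈log₂ k ⌉ * ⌈log₂ k ⌉) ≤ a1 * ⌊log₂ m ⌋ →
  (p : ℕ) → Prime p →
    (ν p ((m + k) C m) ≤ ν p ((2 * m) C m)) ×
    (p ≤ 2 * k → m ^ a2 ≤ p ^ (b2 * (ν p ((2 * m) C m) ∸ ν p ((m + k) C m))))

-- A set P ⊆ ℕ has (lower) asymptotic density 1: for every t ≥ 1 there is N
-- such that for all n ≥ N, at least (1 − 1/t)·n of the integers 1..n lie in P
-- (witnessed by an explicit subset of {1..n}, index i ↦ i+1).
HasDensityOne : (ℕ → Set) → Set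
HasDensityOne P =
  (t : ℕ) → 1 ≤ t → Σ ℕ λ N → (n : ℕ) → N ≤ n →
    Σ (Subset n) λ s →
      ((i : Fin n) → i ∈ s → P (suc (toℕ i))) ×
      ((t ∸ 1) * n ≤ t * ∣ s ∣)

{-# OPTIONS --safe #-}
module Submission where

-- The constants are c₁ = 1/√480 and c₂ = 1/12. Fix n and let H be the largest h with
-- 480 h² ≤ log₂ n, so every admissible k has k ≤ 2^H and only primes p ≤ 2k ≤ 2^(H+1)
-- need a gap. By Kummer's theorem ν_p C(a + b, a) counts the carries of a + b in base p.
-- If 2k < p, every carry of m + k is also a carry of m + m. If p ≤ 2k, call m exceptional
-- for p when its digits at positions H, …, 3H + 1 all equal p − 1, or when m + m has fewer
-- than U + a carries in its lowest 12a digits (U = 3H + 2, and a is the number of base-p¹²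
-- digits of n). Otherwise the carries of m + k stop before position U, so
-- ν_p C(m + k, m) ≤ U ≤ ν_p C(2m, m) − a, and m ≤ n < p^(12a) gives the claim.
-- Such runs of digits p − 1 occur for about n / p^(2H+2) + p^H values m ≤ n. For the carries,
-- weight each residue r mod p^J, J = 12a, by 2^(number of non-carries of r + r): the digits
-- contribute independently, so the total weight is at most ((3p + 1)/2)^J, and Markov's inequality
-- together with 4 (3p + 1)¹² ≤ (4p)¹² leaves O(n 2^(−25H)) values of m. Summed over all
-- bases p ≤ 2^(H+1), the exceptional m ≤ n number O(n 2^(−H)) = o(n).

open import Data.Fin as Fin using (Fin; toℕ)
open import Data.Fin.Properties using (toℕ<n)
open import Data.Fin.Subset using (Subset; _∈_; ∣_∣)
open import Data.Nat
open import Data.Nat.Combinatorics using (_C_; nCk≡n!/k![n-k]!; k![n∸k]!∣n!)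
open import Data.Nat.Divisibility
open import Data.Nat.DivMod
open import Data.Nat.Induction using (<-wellFounded)
open import Data.Nat.Logarithm using (⌊log₂_⌋; ⌈log₂_⌉; ⌊log₂⌋-mono-≤; ⌊log₂[2^n]⌋≡n)
open import Data.Nat.Logarithm.Core using (⌊log2⌋; ⌈log2⌉)
open import Data.Nat.Primality using (Prime; euclidsLemma; ¬prime[0]; ¬prime[1])
open import Data.Nat.Properties
open import Algebra.Properties.CommutativeSemigroup +-commutativeSemigroup
  using () renaming (interchange to +-interchange)
open import Data.Nat.Tactic.RingSolver using (solve-∀)
open import Data.Product using (Σ; _×_; _,_; proj₁; proj₂)
open import Data.Sum using (inj₁; inj₂; [_,_]′)
open import Data.Unit using (tt)
open import Data.Vec using ([]; _∷_; there)
open import Function using (_∘_; _⇔_; mk⇔; Equivalence)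
open import Induction.WellFounded using (Acc; acc)
open import Relation.Binary.PropositionalEquality
  using (_≡_; refl; sym; trans; cong; cong₂; subst; subst₂; module ≡-Reasoning)
open import Relation.Nullary using (Dec; yes; no; ¬_; does; contradiction)
import Relation.Unary as U

open import Defs

variable
  A B : Set
  f g : ℕ → ℕ

∑< : ℕ → (ℕ → ℕ) → ℕ
∑< zero    f = 0
∑< (suc n) f = f 0 + ∑< n (f ∘ suc)

syntax ∑< n (λ i → e) = ∑[ i < n ] e

∑-cong : ∀ n → (∀ i → i < n → f i ≡ g i) → ∑< n f ≡ ∑< n g
∑-cong zero    _  = refl
∑-cong (suc n) eq = cong₂ _+_ (eq 0 z<s) (∑-cong n (λ i → eq (suc i) ∘ s<s))

∑-zero : ∀ n → (∀ i → i < n → f i ≡ 0) → ∑< n f ≡ 0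
∑-zero zero    _  = refl
∑-zero (suc n) eq = cong₂ _+_ (eq 0 z<s) (∑-zero n (λ i → eq (suc i) ∘ s<s))

∑-mono-≤ : ∀ n → (∀ i → i < n → f i ≤ g i) → ∑< n f ≤ ∑< n g
∑-mono-≤ zero    _  = z≤n
∑-mono-≤ (suc n) le = +-mono-≤ (le 0 z<s) (∑-mono-≤ n (λ i → le (suc i) ∘ s<s))

∑-distrib-+ : ∀ n → ∑[ i < n ] (f i + g i) ≡ ∑< n f + ∑< n g
∑-distrib-+ zero    = refl
∑-distrib-+ {f} {g} (suc n) =
  trans (cong (f 0 + g 0 +_) (∑-distrib-+ n)) (+-interchange (f 0) (g 0) _ _)

∑-*ˡ : ∀ c n → ∑[ i < n ] (c * f i) ≡ c * ∑< n f
∑-*ˡ c zero    = sym (*-zeroʳ c)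
∑-*ˡ {f} c (suc n) = trans (cong (c * f 0 +_) (∑-*ˡ c n)) (sym (*-distribˡ-+ c (f 0) _))

∑-const : ∀ n c → ∑[ _ < n ] c ≡ n * c
∑-const zero    c = refl
∑-const (suc n) c = cong (c +_) (∑-const n c)

∑-++ : ∀ m n → ∑< (m + n) f ≡ ∑< m f + ∑[ i < n ] f (m + i)
∑-++ zero    n = refl
∑-++ {f} (suc m) n = trans (cong (f 0 +_) (∑-++ m n)) (sym (+-assoc (f 0) _ _))

∑-last : ∀ n → ∑< (suc n) f ≡ ∑< n f + f n
∑-last {f} n = begin
  ∑< (suc n) f
    ≡⟨ cong (λ k → ∑< k f) (+-comm 1 n) ⟩
  ∑< (n + 1) f
    ≡⟨ ∑-++ n 1 ⟩
  ∑< n f + (f (n + 0) + 0)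
    ≡⟨ cong (λ k → ∑< n f + k) (trans (+-identityʳ _) (cong f (+-identityʳ n))) ⟩
  ∑< n f + f n                         ∎
  where open ≡-Reasoning

∑-mono-length : ∀ {m n} → m ≤ n → ∑< m f ≤ ∑< n f
∑-mono-length {f} {m} {n} m≤n = begin
  ∑< m f                               ≤⟨ m≤m+n _ _ ⟩
  ∑< m f + ∑[ i < n ∸ m ] f (m + i)    ≡⟨ ∑-++ m (n ∸ m) ⟨
  ∑< (m + (n ∸ m)) f                   ≡⟨ cong (λ k → ∑< k f) (m+[n∸m]≡n m≤n) ⟩
  ∑< n f                               ∎
  where open ≤-Reasoning

∑-comm : ∀ m n (h : ℕ → ℕ → ℕ) → ∑[ i < m ] ∑[ j < n ] h i j ≡ ∑[ j < n ] ∑[ i < m ] h i j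
∑-comm zero    n h = sym (∑-zero n (λ _ _ → refl))
∑-comm (suc m) n h =
  trans (cong (∑[ j < n ] h 0 j +_) (∑-comm m n (h ∘ suc))) (sym (∑-distrib-+ n))

∑-blocks : ∀ c N → ∑< (c * N) f ≡ ∑[ e < c ] ∑[ r < N ] f (e * N + r)
∑-blocks zero    N = refl
∑-blocks {f} (suc c) N = trans (∑-++ N (c * N)) (cong (∑< N f +_) (trans (∑-blocks c N)
  (∑-cong c (λ e _ → ∑-cong N (λ r _ → cong f (sym (+-assoc N (e * N) r)))))))

∑-periodic : ∀ c M → (∀ m → f (M + m) ≡ f m) → ∑< (c * M) f ≡ c * ∑< M f
∑-periodic zero    M per = refl
∑-periodic {f} (suc c) M per = trans (∑-++ M (c * M))
  (cong (∑< M f +_) (trans (∑-cong (c * M) (λ i _ → per i)) (∑-periodic c M per)))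

∑≡0⇒≡0 : ∀ n → ∑< n f ≡ 0 → ∀ i → i < n → f i ≡ 0
∑≡0⇒≡0 {f} (suc n) eq zero    _       = m+n≡0⇒m≡0 (f 0) eq
∑≡0⇒≡0 {f} (suc n) eq (suc i) (s<s i<n) = ∑≡0⇒≡0 n (m+n≡0⇒n≡0 (f 0) eq) i i<n

∑-≤-mean : ∀ n b → (∀ i → i < n → n * f i ≤ b) → ∑< n f ≤ b
∑-≤-mean zero    b _  = z≤n
∑-≤-mean {f} (suc n) b le = *-cancelˡ-≤ (suc n) (begin
  suc n * ∑< (suc n) f           ≡⟨ ∑-*ˡ {f} (suc n) (suc n) ⟨
  ∑[ i < suc n ] (suc n * f i)   ≤⟨ ∑-mono-≤ (suc n) le ⟩
  ∑[ i < suc n ] b               ≡⟨ ∑-const (suc n) b ⟩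
  suc n * b                      ∎)
  where open ≤-Reasoning

𝟙 : Dec A → ℕ
𝟙 (yes _) = 1
𝟙 (no _)  = 0

𝟙≤1 : (a? : Dec A) → 𝟙 a? ≤ 1
𝟙≤1 (yes _) = ≤-refl
𝟙≤1 (no _)  = z≤n

𝟙-yes : (a? : Dec A) → A → 𝟙 a? ≡ 1
𝟙-yes (yes _) _ = refl
𝟙-yes (no ¬a) a = contradiction a ¬a

𝟙-no : (a? : Dec A) → ¬ A → 𝟙 a? ≡ 0
𝟙-no (yes a) ¬a = contradiction a ¬a
𝟙-no (no _)  _  = refl

𝟙-mono : (a? : Dec A) (b? : Dec B) → (A → B) → 𝟙 a? ≤ 𝟙 b?
𝟙-mono (yes a) b? A→B = ≤-reflexive (sym (𝟙-yes b? (A→B a)))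
𝟙-mono (no _)  _  _   = z≤n

𝟙-cong : (a? : Dec A) (b? : Dec B) → A ⇔ B → 𝟙 a? ≡ 𝟙 b?
𝟙-cong a? b? A⇔B = ≤-antisym (𝟙-mono a? b? (Equivalence.to A⇔B)) (𝟙-mono b? a? (Equivalence.from A⇔B))

𝟙≡0⇒¬ : (a? : Dec A) → 𝟙 a? ≡ 0 → ¬ A
𝟙≡0⇒¬ a? eq a = 0≢1+n (trans (sym eq) (𝟙-yes a? a))

𝟙-≤+𝟙-> : ∀ m n → 𝟙 (m ≤? n) + 𝟙 (n <? m) ≡ 1
𝟙-≤+𝟙-> m n with m ≤? n | n <? m
... | yes m≤n | yes n<m = contradiction m≤n (<⇒≱ n<m)
... | yes _   | no _    = refl
... | no _    | yes _   = refl
... | no m≰n  | no n≮m  = contradiction (≮⇒≥ n≮m) m≰n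

2^𝟙 : (a? : Dec A) → 2 ^ 𝟙 a? ≡ 1 + 𝟙 a?
2^𝟙 (yes _) = refl
2^𝟙 (no _)  = refl

∑-≤-length : ∀ n → (∀ i → f i ≤ 1) → ∑< n f ≤ n
∑-≤-length zero    _  = z≤n
∑-≤-length (suc n) le = +-mono-≤ (le 0) (∑-≤-length n (le ∘ suc))

∑-≤-support : ∀ n U → (∀ i → f i ≤ 1) → (∀ i → U ≤ i → f i ≡ 0) → ∑< n f ≤ U
∑-≤-support {f} n U le vanish with n ≤? U
... | yes n≤U = ≤-trans (∑-≤-length n le) n≤U
... | no  n≰U = begin
  ∑< n f                                ≡⟨ cong (λ k → ∑< k f) (m+[n∸m]≡n U≤n) ⟨
  ∑< (U + (n ∸ U)) f                    ≡⟨ ∑-++ U (n ∸ U) ⟩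
  ∑< U f + ∑[ i < n ∸ U ] f (U + i)     ≡⟨ cong (∑< U f +_) tail≡0 ⟩
  ∑< U f + 0                            ≡⟨ +-identityʳ _ ⟩
  ∑< U f                                ≤⟨ ∑-≤-length U le ⟩
  U                                     ∎
  where
  open ≤-Reasoning
  U≤n : U ≤ n
  U≤n = <⇒≤ (≰⇒> n≰U)
  tail≡0 : ∑[ i < n ∸ U ] f (U + i) ≡ 0
  tail≡0 = ∑-zero (n ∸ U) (λ i _ → vanish (U + i) (m≤m+n U i))

∑-𝟙-≤ : ∀ n {v} → v ≤ n → ∑[ i < n ] 𝟙 (suc i ≤? v) ≡ v
∑-𝟙-≤ n {zero} _ = ∑-zero n (λ i _ → 𝟙-no (suc i ≤? 0) λ ())
∑-𝟙-≤ (suc n) {suc v} (s≤s v≤n) =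
  cong suc (trans (∑-cong n (λ i _ → 𝟙-cong (2+ i ≤? suc v) (suc i ≤? v) (mk⇔ s≤s⁻¹ s≤s))) (∑-𝟙-≤ n v≤n))

-- Division with carries

[m+n]/o≡m/o+n/o+carry : ∀ m n o .{{_ : NonZero o}} →
                        (m + n) / o ≡ m / o + n / o + 𝟙 (o ≤? m % o + n % o)
[m+n]/o≡m/o+n/o+carry m n o = begin
  (m + n) / o                                  ≡⟨ cong (_/ o) digits ⟩
  (m % o + n % o + (m / o + n / o) * o) / o    ≡⟨ +-distrib-/-∣ʳ (m % o + n % o) (n∣m*n (m / o + n / o)) ⟩
  (m % o + n % o) / o + (m / o + n / o) * o / o ≡⟨ cong₂ _+_ low-digit (m*n/n≡m _ o) ⟩
  𝟙 (o ≤? m % o + n % o) + (m / o + n / o)      ≡⟨ +-comm (𝟙 (o ≤? m % o + n % o)) _ ⟩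
  m / o + n / o + 𝟙 (o ≤? m % o + n % o)        ∎
  where
  open ≡-Reasoning
  digits : m + n ≡ m % o + n % o + (m / o + n / o) * o
  digits = trans (cong₂ _+_ (m≡m%n+[m/n]*n m o) (m≡m%n+[m/n]*n n o))
                 (shuffle (m % o) (n % o) (m / o) (n / o) o)
    where
    shuffle : ∀ r s u v w → r + u * w + (s + v * w) ≡ r + s + (u + v) * w
    shuffle = solve-∀
  low-digit : (m % o + n % o) / o ≡ 𝟙 (o ≤? m % o + n % o)
  low-digit with o ≤? m % o + n % o
  ... | no  o≰r = m<n⇒m/n≡0 (≰⇒> o≰r)
  ... | yes o≤r = trans (m/n≡1+[m∸n]/n o≤r)
    (cong suc (m<n⇒m/n≡0 (m<n+o⇒m∸n<o _ o (+-mono-< (m%n<n m o) (m%n<n n o)))))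

[1+n]/o≡n/o+[o∣1+n] : ∀ n o .{{_ : NonZero o}} → 1 < o → suc n / o ≡ n / o + 𝟙 (o ∣? suc n)
[1+n]/o≡n/o+[o∣1+n] n o 1<o = begin
  suc n / o
    ≡⟨ cong (_/ o) (+-comm 1 n) ⟩
  (n + 1) / o
    ≡⟨ [m+n]/o≡m/o+n/o+carry n 1 o ⟩
  n / o + 1 / o + 𝟙 (o ≤? n % o + 1 % o)
    ≡⟨ cong₂ (λ u v → n / o + u + 𝟙 (o ≤? n % o + v)) (m<n⇒m/n≡0 1<o) (m<n⇒m%n≡m 1<o) ⟩
  n / o + 0 + 𝟙 (o ≤? n % o + 1)
    ≡⟨ cong₂ _+_ (+-identityʳ _) (𝟙-cong (o ≤? n % o + 1) (o ∣? suc n) (mk⇔ to from)) ⟩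
  n / o + 𝟙 (o ∣? suc n)                      ∎
  where
  open ≡-Reasoning
  to : o ≤ n % o + 1 → o ∣ suc n
  to o≤r+1 = divides (suc (n / o)) (begin
    suc n                    ≡⟨ cong suc (trans (m≡m%n+[m/n]*n n o) (+-comm (n % o) _)) ⟩
    suc (n / o * o + n % o)  ≡⟨ +-suc _ _ ⟨
    n / o * o + suc (n % o)  ≡⟨ cong (n / o * o +_) r+1≡o ⟩
    n / o * o + o            ≡⟨ +-comm _ o ⟩
    suc (n / o) * o          ∎)
    where
    r+1≡o : suc (n % o) ≡ o
    r+1≡o = ≤-antisym (m%n<n n o) (subst (o ≤_) (+-comm _ 1) o≤r+1)
  from : o ∣ suc n → o ≤ n % o + 1
  from o∣1+n = ≤-reflexive (begin
    o                ≡⟨ m∸n+n≡m (<⇒≤ 1<o) ⟨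
    o ∸ 1 + 1        ≡⟨ cong (_+ 1) (%-pred-≡0 (n∣m⇒m%n≡0 (suc n) o o∣1+n)) ⟨
    n % o + 1        ∎)

n≤[1+n/m]*m : ∀ n m .{{_ : NonZero m}} → n ≤ suc (n / m) * m
n≤[1+n/m]*m n m = begin
  n                    ≡⟨ m≡m%n+[m/n]*n n m ⟩
  n % m + n / m * m    ≤⟨ +-monoˡ-≤ (n / m * m) (m%n≤n n m) ⟩
  suc (n / m) * m      ∎
  where open ≤-Reasoning

∑-≤-periodic : ∀ n M .{{_ : NonZero M}} → (∀ m → f (M + m) ≡ f m) → ∑< n f ≤ suc (n / M) * ∑< M f
∑-≤-periodic n M per =
  ≤-trans (∑-mono-length (n≤[1+n/m]*m n M)) (≤-reflexive (∑-periodic (suc (n / M)) M per))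

∑-𝟙-≤+ : ∀ N M X → N ≤ M → ∑[ r < N ] 𝟙 (M ≤? r + X) ≤ N + X ∸ M
∑-𝟙-≤+ zero    M X _     = z≤n
∑-𝟙-≤+ (suc N) M X 1+N≤M = begin
  ∑[ r < suc N ] 𝟙 (M ≤? r + X)               ≡⟨ ∑-last N ⟩
  ∑[ r < N ] 𝟙 (M ≤? r + X) + 𝟙 (M ≤? N + X)  ≤⟨ +-monoˡ-≤ _ (∑-𝟙-≤+ N M X (<⇒≤ 1+N≤M)) ⟩
  N + X ∸ M + 𝟙 (M ≤? N + X)                  ≤⟨ last (M ≤? N + X) ⟩
  suc N + X ∸ M                               ∎
  where
  open ≤-Reasoning
  last : (d : Dec (M ≤ N + X)) → N + X ∸ M + 𝟙 d ≤ suc N + X ∸ M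
  last (yes M≤N+X) = ≤-reflexive (trans (+-comm _ 1) (sym (+-∸-assoc 1 M≤N+X)))
  last (no _)      = ≤-trans (≤-reflexive (+-identityʳ _)) (∸-monoˡ-≤ M (n≤1+n (N + X)))

n≤⌈n/2⌉+⌈n/2⌉ : ∀ n → n ≤ ⌈ n /2⌉ + ⌈ n /2⌉
n≤⌈n/2⌉+⌈n/2⌉ n = subst (_≤ ⌈ n /2⌉ + ⌈ n /2⌉) (⌊n/2⌋+⌈n/2⌉≡n n) (+-monoˡ-≤ ⌈ n /2⌉ (⌊n/2⌋≤⌈n/2⌉ n))

⌊n/2⌋+⌊n/2⌋≤n : ∀ n → ⌊ n /2⌋ + ⌊ n /2⌋ ≤ n
⌊n/2⌋+⌊n/2⌋≤n n = subst (⌊ n /2⌋ + ⌊ n /2⌋ ≤_) (⌊n/2⌋+⌈n/2⌉≡n n) (+-monoʳ-≤ ⌊ n /2⌋ (⌊n/2⌋≤⌈n/2⌉ n))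

⌈n/2⌉+⌈n/2⌉≤1+n : ∀ n → ⌈ n /2⌉ + ⌈ n /2⌉ ≤ suc n
⌈n/2⌉+⌈n/2⌉≤1+n n =
  subst (⌈ n /2⌉ + ⌈ n /2⌉ ≤_) (⌊n/2⌋+⌈n/2⌉≡n (suc n)) (+-monoʳ-≤ ⌈ n /2⌉ (⌊n/2⌋≤⌈n/2⌉ (suc n)))

∑-𝟙-double< : ∀ N P → ∑[ e < N ] 𝟙 (e + e <? P) ≤ ⌈ P /2⌉
∑-𝟙-double< N P = ∑-≤-support N ⌈ P /2⌉ (λ e → 𝟙≤1 (e + e <? P))
  (λ e ⌈P/2⌉≤e → 𝟙-no (e + e <? P) (≤⇒≯ (≤-trans (n≤⌈n/2⌉+⌈n/2⌉ P) (+-mono-≤ ⌈P/2⌉≤e ⌈P/2⌉≤e))))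

2^⌊log₂n⌋≤n : ∀ {n} → 0 < n → 2 ^ ⌊log₂ n ⌋ ≤ n
2^⌊log₂n⌋≤n {n} 0<n = go n (<-wellFounded n) 0<n
  where
  go : ∀ n (rec : Acc _<_ n) → 0 < n → 2 ^ ⌊log2⌋ n rec ≤ n
  go 1             _          _ = ≤-refl
  go (suc (suc n)) (acc rs) _ = begin
    2 * 2 ^ e                     ≡⟨ cong (2 ^ e +_) (+-identityʳ _) ⟩
    2 ^ e + 2 ^ e                 ≤⟨ +-mono-≤ ih ih ⟩
    suc ⌊ n /2⌋ + suc ⌊ n /2⌋     ≡⟨ cong suc (+-suc _ _) ⟩
    2 + (⌊ n /2⌋ + ⌊ n /2⌋)       ≤⟨ s≤s (s≤s (⌊n/2⌋+⌊n/2⌋≤n n)) ⟩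
    2 + n                         ∎
    where
    open ≤-Reasoning
    e = ⌊log2⌋ (suc ⌊ n /2⌋) (rs (⌊n/2⌋<n (suc n)))
    ih = go (suc ⌊ n /2⌋) (rs (⌊n/2⌋<n (suc n))) z<s

n≤2^⌈log₂n⌉ : ∀ n → n ≤ 2 ^ ⌈log₂ n ⌉
n≤2^⌈log₂n⌉ n = go n (<-wellFounded n)
  where
  go : ∀ n (rec : Acc _<_ n) → n ≤ 2 ^ ⌈log2⌉ n rec
  go 0             _        = z≤n
  go 1             _        = ≤-refl
  go (suc (suc n)) (acc rs) = begin
    2 + n                         ≤⟨ s≤s (s≤s (n≤⌈n/2⌉+⌈n/2⌉ n)) ⟩
    2 + (⌈ n /2⌉ + ⌈ n /2⌉)       ≡⟨ cong suc (+-suc _ _) ⟨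
    suc ⌈ n /2⌉ + suc ⌈ n /2⌉     ≤⟨ +-mono-≤ ih ih ⟩
    2 ^ e + 2 ^ e                 ≡⟨ cong (2 ^ e +_) (+-identityʳ _) ⟨
    2 * 2 ^ e                     ∎
    where
    open ≤-Reasoning
    e = ⌈log2⌉ (suc ⌈ n /2⌉) (rs (⌈n/2⌉<n n))
    ih = go (suc ⌈ n /2⌉) (rs (⌈n/2⌉<n n))

n<m^n : ∀ {m} → 1 < m → ∀ n → n < m ^ n
n<m^n         1<m zero    = z<s
n<m^n {m} 1<m (suc n) = begin-strict
  suc n           <⟨ s<s (n<m^n 1<m n) ⟩
  suc (m ^ n)     ≤⟨ +-monoˡ-≤ (m ^ n) (m^n>0 m n) ⟩
  m ^ n + m ^ n   ≡⟨ cong (m ^ n +_) (+-identityʳ _) ⟨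
  2 * m ^ n       ≤⟨ *-monoˡ-≤ (m ^ n) 1<m ⟩
  m * m ^ n       ∎
  where
  open ≤-Reasoning
  instance _ = >-nonZero (<-trans z<s 1<m)

module _ {P : ℕ → Set} (P? : U.Decidable P) where

  largest : ℕ → ℕ
  largest zero    = 0
  largest (suc f) with P? (suc f)
  ... | yes _ = suc f
  ... | no  _ = largest f

  largest-satisfies : P 0 → ∀ f → P (largest f)
  largest-satisfies P0 zero    = P0
  largest-satisfies P0 (suc f) with P? (suc f)
  ... | yes Pf = Pf
  ... | no  _  = largest-satisfies P0 f

  ≤-largest : ∀ {h} f → h ≤ f → P h → h ≤ largest f
  ≤-largest         zero    h≤f _  = h≤f
  ≤-largest {h} (suc f) h≤f Ph with P? (suc f)
  ... | yes _ = h≤f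
  ... | no ¬Pf with m≤n⇒m<n∨m≡n h≤f
  ...   | inj₁ h<1+f = ≤-largest f (s≤s⁻¹ h<1+f) Ph
  ...   | inj₂ refl  = contradiction Ph ¬Pf

digits : ℕ → ℕ → ℕ
digits Q n = suc (largest (λ e → Q ^ e ≤? n) n)

n<Q^digits : ∀ {Q} → 1 < Q → ∀ n → n < Q ^ digits Q n
n<Q^digits {Q} 1<Q n = ≰⇒> λ Q^d≤n →
  1+n≰n (≤-largest (λ e → Q ^ e ≤? n) n (<⇒≤ (<-≤-trans (n<m^n 1<Q _) Q^d≤n)) Q^d≤n)

Q^digits≤Q*n : ∀ Q {n} → 0 < n → Q ^ digits Q n ≤ Q * n
Q^digits≤Q*n Q {n} 0<n = *-monoʳ-≤ Q (largest-satisfies (λ e → Q ^ e ≤? n) 0<n n)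

^-distribʳ-* : ∀ x y n → (x * y) ^ n ≡ x ^ n * y ^ n
^-distribʳ-* x y zero    = refl
^-distribʳ-* x y (suc n) = trans (cong (x * y *_) (^-distribʳ-* x y n)) (shuffle x y (x ^ n) (y ^ n))
  where
  shuffle : ∀ a b c d → a * b * (c * d) ≡ a * c * (b * d)
  shuffle = solve-∀

4*[3p+1]^12≤[4p]^12 : ∀ p → 2 ≤ p → 4 * (3 * p + 1) ^ 12 ≤ (4 * p) ^ 12
4*[3p+1]^12≤[4p]^12 p 2≤p = *-cancelʳ-≤ (4 * (3 * p + 1) ^ 12) ((4 * p) ^ 12) (8 ^ 12) (begin
  4 * (3 * p + 1) ^ 12 * 8 ^ 12      ≡⟨ *-assoc 4 ((3 * p + 1) ^ 12) (8 ^ 12) ⟩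
  4 * ((3 * p + 1) ^ 12 * 8 ^ 12)    ≡⟨ cong (4 *_) (^-distribʳ-* (3 * p + 1) 8 12) ⟨
  4 * ((3 * p + 1) * 8) ^ 12         ≤⟨ *-monoʳ-≤ 4 (^-monoˡ-≤ 12 linear) ⟩
  4 * (7 * (4 * p)) ^ 12             ≡⟨ cong (4 *_) (^-distribʳ-* 7 (4 * p) 12) ⟩
  4 * (7 ^ 12 * (4 * p) ^ 12)        ≡⟨ *-assoc 4 (7 ^ 12) ((4 * p) ^ 12) ⟨
  4 * 7 ^ 12 * (4 * p) ^ 12          ≤⟨ *-monoˡ-≤ ((4 * p) ^ 12) (≤ᵇ⇒≤ (4 * 7 ^ 12) (8 ^ 12) tt) ⟩
  8 ^ 12 * (4 * p) ^ 12              ≡⟨ *-comm (8 ^ 12) ((4 * p) ^ 12) ⟩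
  (4 * p) ^ 12 * 8 ^ 12              ∎)
  where
  open ≤-Reasoning
  linear : (3 * p + 1) * 8 ≤ 7 * (4 * p)
  linear = begin
    (3 * p + 1) * 8   ≡⟨ expand p ⟩
    24 * p + 8        ≤⟨ +-monoʳ-≤ (24 * p) (*-monoʳ-≤ 4 2≤p) ⟩
    24 * p + 4 * p    ≡⟨ collect p ⟩
    7 * (4 * p)       ∎
    where
    expand : ∀ p → (3 * p + 1) * 8 ≡ 24 * p + 8
    expand = solve-∀
    collect : ∀ p → 24 * p + 4 * p ≡ 7 * (4 * p)
    collect = solve-∀

4^a*[3p+1]^[12a]≤[4p]^[12a] : ∀ p a → 2 ≤ p → 4 ^ a * (3 * p + 1) ^ (12 * a) ≤ (4 * p) ^ (12 * a)
4^a*[3p+1]^[12a]≤[4p]^[12a] p a 2≤p = begin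
  4 ^ a * (3 * p + 1) ^ (12 * a)       ≡⟨ cong (4 ^ a *_) (^-*-assoc (3 * p + 1) 12 a) ⟨
  4 ^ a * ((3 * p + 1) ^ 12) ^ a       ≡⟨ ^-distribʳ-* 4 ((3 * p + 1) ^ 12) a ⟨
  (4 * (3 * p + 1) ^ 12) ^ a           ≤⟨ ^-monoˡ-≤ a (4*[3p+1]^12≤[4p]^12 p 2≤p) ⟩
  ((4 * p) ^ 12) ^ a                   ≡⟨ ^-*-assoc (4 * p) 12 a ⟩
  (4 * p) ^ (12 * a)                   ∎
  where open ≤-Reasoning

-- p-adic valuations

^-monoʳ-∣ : ∀ p {a b} → a ≤ b → p ^ a ∣ p ^ b
^-monoʳ-∣ p {a} {b} a≤b =
  divides (p ^ (b ∸ a)) (trans (cong (p ^_) (sym (m∸n+n≡m a≤b))) (^-distribˡ-+-* p (b ∸ a) a))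

C*!*!≡! : ∀ a b → ((a + b) C a) * (a ! * b !) ≡ (a + b) !
C*!*!≡! a b = begin
  ((a + b) C a) * (a ! * b !)
    ≡⟨ cong (λ c → ((a + b) C a) * (a ! * c !)) (m+n∸m≡n a b) ⟨
  ((a + b) C a) * (a ! * (a + b ∸ a) !)
    ≡⟨ cong (_* (a ! * (a + b ∸ a) !)) (nCk≡n!/k![n-k]! (m≤m+n a b)) ⟩
  (a + b) ! / (a ! * (a + b ∸ a) !) * (a ! * (a + b ∸ a) !)
    ≡⟨ m/n*n≡m (k![n∸k]!∣n! (m≤m+n a b)) ⟩
  (a + b) !                                  ∎
  where
  open ≡-Reasoning
  instance _ = a !* (a + b ∸ a) !≢0

0<C : ∀ a b → 0 < (a + b) C a
0<C a b with (a + b) C a in eq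
... | zero  = contradiction (trans (sym (C*!*!≡! a b)) (cong (_* (a ! * b !)) eq))
                            (≢-nonZero⁻¹ _ {{(a + b) !≢0}})
... | suc _ = z<s

module _ (p : ℕ) .{{_ : NonZero p}} where

  mutual
    valuationLoop : ℕ → ℕ → ℕ
    valuationLoop zero    _       = 0
    valuationLoop (suc f) zero    = 0
    valuationLoop (suc f) (suc x) = valuationStep f x (p ∣? suc x)

    valuationStep : ∀ f x → Dec (p ∣ suc x) → ℕ
    valuationStep f x (yes _) = suc (valuationLoop f (suc x / p))
    valuationStep f x (no _)  = 0

  record UnfoldsLikeValuationLoop (go : ℕ → ℕ → ℕ) : Set where
    field
      out-of-fuel : ∀ x → go 0 x ≡ 0
      at-zero     : ∀ f → go (suc f) 0 ≡ 0
      at-multiple : ∀ f x → p ∣ suc x → go (suc f) (suc x) ≡ suc (go f (suc x / p))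
      at-other    : ∀ f x → ¬ p ∣ suc x → go (suc f) (suc x) ≡ 0

  unfoldsLike⇒≗valuationLoop : ∀ {go} → UnfoldsLikeValuationLoop go → ∀ f x → go f x ≡ valuationLoop f x
  unfoldsLike⇒≗valuationLoop u zero    x       = UnfoldsLikeValuationLoop.out-of-fuel u x
  unfoldsLike⇒≗valuationLoop u (suc f) zero    = UnfoldsLikeValuationLoop.at-zero u f
  unfoldsLike⇒≗valuationLoop u (suc f) (suc x) with p ∣? suc x
  ... | yes p∣x = trans (UnfoldsLikeValuationLoop.at-multiple u f x p∣x)
                        (cong suc (unfoldsLike⇒≗valuationLoop u f (suc x / p)))
  ... | no  p∤x = UnfoldsLikeValuationLoop.at-other u f x p∤x

valuation : (p : ℕ) .{{_ : NonZero p}} → ℕ → ℕ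
valuation p x = valuationLoop p x x

-- `ν` runs a fuelled worker local to its where-block, which cannot be named here. The
-- metavariable `worker` is solved by unification in `unfold-ν` (to that worker, with its
-- unused parameter n), after which its defining equations hold by computation.
ν≡valuation : ∀ q x → ν (2+ q) x ≡ valuation (2+ q) x
ν≡valuation q zero    = refl
ν≡valuation q (suc y) = unfold-ν y
  where
  worker : ℕ → ℕ → ℕ → ℕ
  worker = _
  unfoldsLike : ∀ n → UnfoldsLikeValuationLoop (2+ q) (worker n)
  unfold-ν : ∀ y → ν (2+ q) (suc y) ≡ valuation (2+ q) (suc y)
  unfold-ν y with 2+ q ∣? suc y
  ... | no _ = refl
  ... | yes _ with suc y / 2+ q | suc y
  ... | z | n = cong suc (unfoldsLike⇒≗valuationLoop (2+ q) (unfoldsLike n) y z)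
  unfoldsLike n = record
    { out-of-fuel = λ _ → refl
    ; at-zero     = λ _ → refl
    ; at-multiple = at-multiple
    ; at-other    = at-other
    }
    where
    at-multiple : ∀ f x → 2+ q ∣ suc x → worker n (suc f) (suc x) ≡ suc (worker n f (suc x / 2+ q))
    at-multiple f x p∣x with 2+ q ∣? suc x
    ... | yes _   = refl
    ... | no  p∤x = contradiction p∣x p∤x
    at-other : ∀ f x → ¬ 2+ q ∣ suc x → worker n (suc f) (suc x) ≡ 0
    at-other f x p∤x with 2+ q ∣? suc x
    ... | yes p∣x = contradiction p∣x p∤x
    ... | no  _   = refl

-- Valuations and carries in base p

module Base (p : ℕ) .{{_ : NonTrivial p}} where

  instance
    p≢0 : NonZero p
    p≢0 = nonTrivial⇒nonZero p

  p^≢0 : ∀ j → NonZero (p ^ j)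
  p^≢0 j = m^n≢0 p j

  -- Instance search cannot recover j from `NonZero (p ^ j)`, so these supply the instance.
  _/p^_ _%p^_ : ℕ → ℕ → ℕ
  n /p^ j = (n / p ^ j) {{p^≢0 j}}
  n %p^ j = (n % p ^ j) {{p^≢0 j}}

  -- 1 exactly when a + b carries out of the lowest j digits.
  carry : ℕ → ℕ → ℕ → ℕ
  carry j a b = 𝟙 (p ^ j ≤? a %p^ j + b %p^ j)

  carries : ℕ → ℕ → ℕ → ℕ
  carries J a b = ∑[ i < J ] carry (suc i) a b

  private
    [1+x]/p≤f : ∀ {x f} → x ≤ f → suc x / p ≤ f
    [1+x]/p≤f {x} x≤f = ≤-trans (s≤s⁻¹ (m/n<m (suc x) p (nonTrivial⇒n>1 p))) x≤f

  loop-∣ : ∀ f x → 0 < x → x ≤ f → p ^ valuationLoop p f x ∣ x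
  loop-∣ (suc f) (suc x) _ (s≤s x≤f) with p ∣? suc x
  ... | no  _   = 1∣ _
  ... | yes p∣x = m∣n/o⇒o*m∣n p∣x (loop-∣ f _ (m≥n⇒m/n>0 (∣⇒≤ p∣x)) ([1+x]/p≤f x≤f))

  loop-∤ : ∀ f x → 0 < x → x ≤ f → ¬ p ^ suc (valuationLoop p f x) ∣ x
  loop-∤ (suc f) (suc x) _ (s≤s x≤f) with p ∣? suc x
  ... | no  p∤x = p∤x ∘ subst (_∣ suc x) (*-identityʳ p)
  ... | yes p∣x = loop-∤ f _ (m≥n⇒m/n>0 (∣⇒≤ p∣x)) ([1+x]/p≤f x≤f) ∘ m*n∣o⇒n∣o/m p _

  valuation-∣ : ∀ {x} → 0 < x → p ^ valuation p x ∣ x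
  valuation-∣ 0<x = loop-∣ _ _ 0<x ≤-refl

  valuation-∤ : ∀ {x} → 0 < x → ¬ p ^ suc (valuation p x) ∣ x
  valuation-∤ 0<x = loop-∤ _ _ 0<x ≤-refl

  ∣⇒≤valuation : ∀ {x e} → 0 < x → p ^ e ∣ x → e ≤ valuation p x
  ∣⇒≤valuation {x} {e} 0<x p^e∣x with e ≤? valuation p x
  ... | yes e≤v = e≤v
  ... | no  e≰v = contradiction (∣-trans (^-monoʳ-∣ p (≰⇒> e≰v)) p^e∣x) (valuation-∤ 0<x)

  ≤valuation⇒∣ : ∀ {x e} → 0 < x → e ≤ valuation p x → p ^ e ∣ x
  ≤valuation⇒∣ 0<x e≤v = ∣-trans (^-monoʳ-∣ p e≤v) (valuation-∣ 0<x)

  valuation-unique : ∀ {x e} → 0 < x → p ^ e ∣ x → ¬ p ^ suc e ∣ x → valuation p x ≡ e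
  valuation-unique {x} {e} 0<x p^e∣x p^1+e∤x with valuation p x ≤? e
  ... | yes v≤e = ≤-antisym v≤e (∣⇒≤valuation 0<x p^e∣x)
  ... | no  v≰e = contradiction (≤valuation⇒∣ 0<x (≰⇒> v≰e)) p^1+e∤x

  valuation<x : ∀ {x} → 0 < x → valuation p x < x
  valuation<x 0<x = <-≤-trans (n<m^n (nonTrivial⇒n>1 p) _) (∣⇒≤ {{>-nonZero 0<x}} (valuation-∣ 0<x))

  carry-≤-double : ∀ {j m k} → k + k < p ^ j → carry j m k ≤ carry j m m
  carry-≤-double {j} {m} {k} 2k<Q = 𝟙-mono (Q ≤? r + k %p^ j) (Q ≤? r + r) Q≤r+k⇒Q≤r+r
    where
    Q = p ^ j
    r = m %p^ j
    k%Q≡k : k %p^ j ≡ k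
    k%Q≡k = m<n⇒m%n≡m {{p^≢0 j}} (≤-<-trans (m≤m+n k k) 2k<Q)
    Q≤r+k⇒Q≤r+r : Q ≤ r + k %p^ j → Q ≤ r + r
    Q≤r+k⇒Q≤r+r Q≤r+k = <⇒≤ (+-cancelʳ-< Q Q (r + r) (begin-strict
      Q + Q               ≤⟨ +-mono-≤ Q≤r+k′ Q≤r+k′ ⟩
      (r + k) + (r + k)   ≡⟨ +-interchange r k r k ⟩
      (r + r) + (k + k)   <⟨ +-monoʳ-< (r + r) 2k<Q ⟩
      (r + r) + Q         ∎))
      where
      open ≤-Reasoning
      Q≤r+k′ : Q ≤ r + k
      Q≤r+k′ = subst (λ x → Q ≤ r + x) k%Q≡k Q≤r+k

  %p^-+-<-step : ∀ {j m X} → m %p^ j + X < p ^ j → m %p^ suc j + X < p ^ suc j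
  %p^-+-<-step {j} {m} {X} r+X<Q = begin-strict
    R + X                        ≡⟨ cong (_+ X) R≡ ⟩
    m % Q + R / Q * Q + X        ≡⟨ +-assoc (m % Q) _ X ⟩
    m % Q + (R / Q * Q + X)      ≡⟨ cong (m % Q +_) (+-comm _ X) ⟩
    m % Q + (X + R / Q * Q)      ≡⟨ +-assoc (m % Q) X _ ⟨
    m % Q + X + R / Q * Q        <⟨ +-monoˡ-< _ r+X<Q ⟩
    suc (R / Q) * Q              ≤⟨ *-monoˡ-≤ Q R/Q<p ⟩
    p * Q                        ∎
    where
    open ≤-Reasoning
    Q = p ^ j
    instance
      _ = p^≢0 j
      _ = p^≢0 (suc j)
    R = m % (p * Q)
    R≡ : R ≡ m % Q + R / Q * Q
    R≡ = trans (m≡m%n+[m/n]*n R Q) (cong (_+ R / Q * Q) (m∣n⇒o%n%m≡o%m Q (p * Q) m (n∣m*n p)))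
    R/Q<p : R / Q < p
    R/Q<p = subst (_< p) (sym (m%[n*o]/o≡m/o%n m p Q)) (m%n<n (m / Q) p)

  %p^-+-<-mono : ∀ {U j m X} → U ≤ j → m %p^ U + X < p ^ U → m %p^ j + X < p ^ j
  %p^-+-<-mono {j = zero}  z≤n   h = h
  %p^-+-<-mono {j = suc j} U≤1+j h with m≤n⇒m<n∨m≡n U≤1+j
  ... | inj₁ U<1+j = %p^-+-<-step {j} (%p^-+-<-mono (s≤s⁻¹ U<1+j) h)
  ... | inj₂ refl  = h

  carry≡0-beyond-run : ∀ {U H j m k} → m %p^ U + p ^ H < p ^ U → k ≤ p ^ H → U ≤ j → carry j m k ≡ 0
  carry≡0-beyond-run {U} {H} {j} {m} {k} run k≤p^H U≤j =
    𝟙-no (p ^ j ≤? m %p^ j + k %p^ j) (<⇒≱ (begin-strict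
      m %p^ j + k %p^ j   ≤⟨ +-monoʳ-≤ (m %p^ j) (≤-trans (m%n≤m k (p ^ j) {{p^≢0 j}}) k≤p^H) ⟩
      m %p^ j + p ^ H     <⟨ %p^-+-<-mono U≤j run ⟩
      p ^ j               ∎))
    where open ≤-Reasoning

  module _ (p-prime : Prime p) where

    valuation-* : ∀ {x y} → 0 < x → 0 < y → valuation p (x * y) ≡ valuation p x + valuation p y
    valuation-* {x} {y} 0<x 0<y with valuation-∣ 0<x | valuation-∣ 0<y
    ... | divides x′ x≡x′p^a | divides y′ y≡y′p^b =
      valuation-unique (*-mono-≤ 0<x 0<y) p^a+b∣xy p^1+a+b∤xy
      where
      a = valuation p x
      b = valuation p y
      xy≡ : x * y ≡ p ^ (a + b) * (x′ * y′)
      xy≡ = begin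
        x * y                          ≡⟨ cong₂ _*_ x≡x′p^a y≡y′p^b ⟩
        x′ * p ^ a * (y′ * p ^ b)      ≡⟨ shuffle x′ y′ (p ^ a) (p ^ b) ⟩
        p ^ a * p ^ b * (x′ * y′)      ≡⟨ cong (_* (x′ * y′)) (^-distribˡ-+-* p a b) ⟨
        p ^ (a + b) * (x′ * y′)        ∎
        where
        open ≡-Reasoning
        shuffle : ∀ s t u v → s * u * (t * v) ≡ u * v * (s * t)
        shuffle = solve-∀
      p^a+b∣xy : p ^ (a + b) ∣ x * y
      p^a+b∣xy = subst (p ^ (a + b) ∣_) (sym xy≡) (m∣m*n _)
      p∤x′ : ¬ p ∣ x′
      p∤x′ p∣x′ = valuation-∤ 0<x (subst (p * p ^ a ∣_) (sym x≡x′p^a) (*-monoˡ-∣ (p ^ a) p∣x′))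
      p∤y′ : ¬ p ∣ y′
      p∤y′ p∣y′ = valuation-∤ 0<y (subst (p * p ^ b ∣_) (sym y≡y′p^b) (*-monoˡ-∣ (p ^ b) p∣y′))
      p^1+a+b∤xy : ¬ p ^ suc (a + b) ∣ x * y
      p^1+a+b∤xy p^1+a+b∣xy = [ p∤x′ , p∤y′ ]′ (euclidsLemma x′ y′ p-prime p∣x′y′)
        where
        p∣x′y′ : p ∣ x′ * y′
        p∣x′y′ = *-cancelˡ-∣ (p ^ (a + b)) {{p^≢0 (a + b)}}
          (subst₂ _∣_ (*-comm p (p ^ (a + b))) xy≡ p^1+a+b∣xy)

    valuation-1 : valuation p 1 ≡ 0
    valuation-1 = valuation-unique z<s (1∣ 1) (>⇒∤ (subst (1 <_) (sym (*-identityʳ p)) (nonTrivial⇒n>1 p)))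

    ∑-𝟙-∣≡valuation : ∀ F {x} → 0 < x → x ≤ suc F → ∑[ i < F ] 𝟙 (p ^ suc i ∣? x) ≡ valuation p x
    ∑-𝟙-∣≡valuation F {x} 0<x x≤1+F = begin
      ∑[ i < F ] 𝟙 (p ^ suc i ∣? x)
        ≡⟨ ∑-cong F (λ i _ → 𝟙-cong (p ^ suc i ∣? x) (suc i ≤? valuation p x)
            (mk⇔ (∣⇒≤valuation 0<x) (≤valuation⇒∣ 0<x))) ⟩
      ∑[ i < F ] 𝟙 (suc i ≤? valuation p x)
        ≡⟨ ∑-𝟙-≤ F (s≤s⁻¹ (<-≤-trans (valuation<x 0<x) x≤1+F)) ⟩
      valuation p x                          ∎
      where open ≡-Reasoning

    legendre : ∀ F {n} → n ≤ F → valuation p (n !) ≡ ∑[ i < F ] (n /p^ suc i)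
    legendre F {zero}  _     = trans valuation-1 (sym (∑-zero F (λ i _ → 0/n≡0 (p ^ suc i) {{p^≢0 (suc i)}})))
    legendre F {suc n} 1+n≤F = begin
      valuation p (suc n * n !)
        ≡⟨ valuation-* z<s (1≤n! n) ⟩
      valuation p (suc n) + valuation p (n !)
        ≡⟨ cong₂ _+_ (∑-𝟙-∣≡valuation F z<s (m≤n⇒m≤1+n 1+n≤F))
            (sym (legendre F (<⇒≤ 1+n≤F))) ⟨
      ∑[ i < F ] 𝟙 (p ^ suc i ∣? suc n) + ∑[ i < F ] (n /p^ suc i)
        ≡⟨ +-comm (∑[ i < F ] 𝟙 (p ^ suc i ∣? suc n)) _ ⟩
      ∑[ i < F ] (n /p^ suc i) + ∑[ i < F ] 𝟙 (p ^ suc i ∣? suc n)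
        ≡⟨ ∑-distrib-+ F ⟨
      ∑[ i < F ] (n /p^ suc i + 𝟙 (p ^ suc i ∣? suc n))
        ≡⟨ ∑-cong F (λ i _ → [1+n]/o≡n/o+[o∣1+n] n (p ^ suc i) {{p^≢0 (suc i)}} (p^1+i>1 i)) ⟨
      ∑[ i < F ] (suc n /p^ suc i)                                       ∎
      where
      open ≡-Reasoning
      p^1+i>1 : ∀ i → 1 < p ^ suc i
      p^1+i>1 i = ≤-trans (nonTrivial⇒n>1 p) (m≤m*n p (p ^ i) {{p^≢0 i}})

    legendre-+ : ∀ F a b → ∑[ i < F ] ((a + b) /p^ suc i)
                           ≡ ∑[ i < F ] (a /p^ suc i) + ∑[ i < F ] (b /p^ suc i) + carries F a b
    legendre-+ F a b = begin
      ∑[ i < F ] ((a + b) /p^ suc i)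
        ≡⟨ ∑-cong F (λ i _ → [m+n]/o≡m/o+n/o+carry a b (p ^ suc i) {{p^≢0 (suc i)}}) ⟩
      ∑[ i < F ] (a /p^ suc i + b /p^ suc i + carry (suc i) a b)
        ≡⟨ ∑-distrib-+ F ⟩
      ∑[ i < F ] (a /p^ suc i + b /p^ suc i) + carries F a b
        ≡⟨ cong (_+ carries F a b) (∑-distrib-+ F) ⟩
      ∑[ i < F ] (a /p^ suc i) + ∑[ i < F ] (b /p^ suc i) + carries F a b      ∎
      where open ≡-Reasoning

    kummer : ∀ F a b → a + b ≤ F → valuation p ((a + b) C a) ≡ carries F a b
    kummer F a b a+b≤F = +-cancelʳ-≡ (L a + L b) _ _ (begin
      valuation p ((a + b) C a) + (L a + L b)
        ≡⟨ cong (valuation p ((a + b) C a) +_) (cong₂ _+_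
            (legendre F (≤-trans (m≤m+n a b) a+b≤F))
            (legendre F (≤-trans (m≤n+m b a) a+b≤F))) ⟨
      valuation p ((a + b) C a) + (valuation p (a !) + valuation p (b !))
        ≡⟨ cong (valuation p ((a + b) C a) +_) (valuation-* (1≤n! a) (1≤n! b)) ⟨
      valuation p ((a + b) C a) + valuation p (a ! * b !)
        ≡⟨ valuation-* (0<C a b) (*-mono-≤ (1≤n! a) (1≤n! b)) ⟨
      valuation p (((a + b) C a) * (a ! * b !))
        ≡⟨ cong (valuation p) (C*!*!≡! a b) ⟩
      valuation p ((a + b) !)
        ≡⟨ legendre F a+b≤F ⟩
      L (a + b)
        ≡⟨ legendre-+ F a b ⟩
      L a + L b + carries F a b
        ≡⟨ +-comm (L a + L b) _ ⟩
      carries F a b + (L a + L b)                                     ∎)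
      where
      open ≡-Reasoning
      L : ℕ → ℕ
      L n = ∑[ i < F ] (n /p^ suc i)

    valuation-C[2m,m] : ∀ F m → m + m ≤ F → valuation p ((2 * m) C m) ≡ carries F m m
    valuation-C[2m,m] F m 2m≤F =
      trans (cong (λ n → valuation p (n C m)) (cong (m +_) (+-identityʳ m))) (kummer F m m 2m≤F)

    valuation-C-mono : ∀ m k → k + k < p → valuation p ((m + k) C m) ≤ valuation p ((2 * m) C m)
    valuation-C-mono m k 2k<p = begin
      valuation p ((m + k) C m)
        ≡⟨ kummer F m k (+-monoˡ-≤ k (m≤m+n m m)) ⟩
      carries F m k
        ≤⟨ ∑-mono-≤ F (λ i _ → carry-≤-double {suc i} (<-≤-trans 2k<p (m≤m*n p (p ^ i) {{p^≢0 i}}))) ⟩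
      carries F m m
        ≡⟨ valuation-C[2m,m] F m (m≤m+n (m + m) k) ⟨
      valuation p ((2 * m) C m)   ∎
      where
      open ≤-Reasoning
      F = m + m + k

    valuation-C≤ : ∀ {U H m k} → m %p^ U + p ^ H < p ^ U → k ≤ p ^ H → valuation p ((m + k) C m) ≤ U
    valuation-C≤ {U} {H} {m} {k} run k≤p^H = begin
      valuation p ((m + k) C m)   ≡⟨ kummer (m + k) m k ≤-refl ⟩
      carries (m + k) m k         ≤⟨ ∑-≤-support (m + k) U (λ i → 𝟙≤1 _)
                                       (λ i U≤i → carry≡0-beyond-run {H = H} run k≤p^H (m≤n⇒m≤1+n U≤i)) ⟩
      U                           ∎
      where open ≤-Reasoning

    carries≤valuation-C : ∀ J m → carries J m m ≤ valuation p ((2 * m) C m)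
    carries≤valuation-C J m = begin
      carries J m m               ≤⟨ ∑-mono-length (m≤n+m J (m + m)) ⟩
      carries (m + m + J) m m     ≡⟨ valuation-C[2m,m] (m + m + J) m (m≤m+n (m + m) J) ⟨
      valuation p ((2 * m) C m)   ∎
      where open ≤-Reasoning

  noncarries : ℕ → ℕ → ℕ
  noncarries J r = ∑[ i < J ] 𝟙 (r %p^ suc i + r %p^ suc i <? p ^ suc i)

  carries+noncarries : ∀ J r → carries J r r + noncarries J r ≡ J
  carries+noncarries J r = begin
    carries J r r + noncarries J r   ≡⟨ ∑-distrib-+ J ⟨
    ∑[ i < J ] (carry (suc i) r r + 𝟙 (r %p^ suc i + r %p^ suc i <? p ^ suc i))
                                     ≡⟨ ∑-cong J (λ i _ → 𝟙-≤+𝟙-> (p ^ suc i) (r %p^ suc i + r %p^ suc i)) ⟩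
    ∑[ i < J ] 1                     ≡⟨ ∑-const J 1 ⟩
    J * 1                            ≡⟨ *-identityʳ J ⟩
    J                                ∎
    where open ≡-Reasoning

  weight : ℕ → ℕ
  weight J = ∑[ r < p ^ J ] (2 ^ noncarries J r)

  fewCarries : ℕ → ℕ → ℕ
  fewCarries J T = ∑[ r < p ^ J ] 𝟙 (carries J r r <? T)

  %p^-remove-high : ∀ {j J} e r → j ≤ J → (e * p ^ J + r) %p^ j ≡ r %p^ j
  %p^-remove-high {j} {J} e r j≤J = %-remove-+ˡ {e * p ^ J} r {{p^≢0 j}} (∣n⇒∣m*n e (^-monoʳ-∣ p j≤J))

  noncarries-top : ∀ {J e r} → e < p → r < p ^ J →
                   noncarries (suc J) (e * p ^ J + r) ≤ 𝟙 (e + e <? p) + noncarries J r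
  noncarries-top {J} {e} {r} e<p r<p^J = begin
    noncarries (suc J) x
      ≡⟨ ∑-last J ⟩
    noncarries J x + 𝟙 top?
      ≡⟨ cong (_+ 𝟙 top?) low-digits ⟩
    noncarries J r + 𝟙 top?
      ≤⟨ +-monoʳ-≤ (noncarries J r) (𝟙-mono top? (e + e <? p) 2x<⇒2e<p) ⟩
    noncarries J r + 𝟙 (e + e <? p)
      ≡⟨ +-comm (noncarries J r) _ ⟩
    𝟙 (e + e <? p) + noncarries J r                        ∎
    where
    open ≤-Reasoning
    N = p ^ J
    x = e * N + r
    top? = x %p^ suc J + x %p^ suc J <? p ^ suc J
    low-digits : noncarries J x ≡ noncarries J r
    low-digits = ∑-cong J (λ i i<J → cong (λ y → 𝟙 (y + y <? p ^ suc i)) (%p^-remove-high e r i<J))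
    x<pN : x < p * N
    x<pN = begin-strict
      e * N + r     <⟨ +-monoʳ-< (e * N) r<p^J ⟩
      e * N + N     ≡⟨ +-comm (e * N) N ⟩
      suc e * N     ≤⟨ *-monoˡ-≤ N e<p ⟩
      p * N         ∎
    2x<⇒2e<p : x %p^ suc J + x %p^ suc J < p ^ suc J → e + e < p
    2x<⇒2e<p 2x<pN = *-cancelʳ-< N (e + e) p (begin-strict
      (e + e) * N                  ≡⟨ *-distribʳ-+ N e e ⟩
      e * N + e * N                ≤⟨ +-mono-≤ (m≤m+n (e * N) r) (m≤m+n (e * N) r) ⟩
      x + x                        ≡⟨ cong (λ y → y + y) (m<n⇒m%n≡m {{p^≢0 (suc J)}} x<pN) ⟨
      x %p^ suc J + x %p^ suc J    <⟨ 2x<pN ⟩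
      p * N                        ∎)

  weight-suc : ∀ J → weight (suc J) ≤ ∑[ e < p ] (2 ^ 𝟙 (e + e <? p)) * weight J
  weight-suc J = begin
    weight (suc J)
      ≡⟨ ∑-blocks p N ⟩
    ∑[ e < p ] ∑[ r < N ] (2 ^ noncarries (suc J) (e * N + r))
      ≤⟨ ∑-mono-≤ p (λ e e<p → ∑-mono-≤ N (λ r r<N →
          ^-monoʳ-≤ 2 (noncarries-top {J} e<p r<N))) ⟩
    ∑[ e < p ] ∑[ r < N ] (2 ^ (𝟙 (e + e <? p) + noncarries J r))
      ≡⟨ ∑-cong p (λ e _ → trans
          (∑-cong N (λ r _ → ^-distribˡ-+-* 2 (𝟙 (e + e <? p)) (noncarries J r)))
          (∑-*ˡ (2 ^ 𝟙 (e + e <? p)) N)) ⟩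
    ∑[ e < p ] (2 ^ 𝟙 (e + e <? p) * weight J)
      ≡⟨ ∑-cong p (λ e _ → *-comm (2 ^ 𝟙 (e + e <? p)) (weight J)) ⟩
    ∑[ e < p ] (weight J * 2 ^ 𝟙 (e + e <? p))
      ≡⟨ ∑-*ˡ (weight J) p ⟩
    weight J * ∑[ e < p ] (2 ^ 𝟙 (e + e <? p))
      ≡⟨ *-comm (weight J) _ ⟩
    ∑[ e < p ] (2 ^ 𝟙 (e + e <? p)) * weight J                           ∎
    where
    open ≤-Reasoning
    N = p ^ J

  2*∑2^𝟙≤3p+1 : 2 * ∑[ e < p ] (2 ^ 𝟙 (e + e <? p)) ≤ 3 * p + 1
  2*∑2^𝟙≤3p+1 = begin
    2 * ∑[ e < p ] (2 ^ 𝟙 (e + e <? p))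
      ≡⟨ cong (2 *_) (trans (∑-cong p (λ e _ → 2^𝟙 (e + e <? p))) (∑-distrib-+ p)) ⟩
    2 * (∑[ e < p ] 1 + ∑[ e < p ] 𝟙 (e + e <? p))
      ≤⟨ *-monoʳ-≤ 2 (+-mono-≤ (≤-reflexive (trans (∑-const p 1) (*-identityʳ p)))
          (∑-𝟙-double< p p)) ⟩
    2 * (p + ⌈ p /2⌉)
      ≡⟨ *-distribˡ-+ 2 p _ ⟩
    2 * p + 2 * ⌈ p /2⌉
      ≤⟨ +-monoʳ-≤ (2 * p) (subst (_≤ suc p) (cong (⌈ p /2⌉ +_) (sym (+-identityʳ _)))
          (⌈n/2⌉+⌈n/2⌉≤1+n p)) ⟩
    2 * p + suc p
      ≡⟨ arith p ⟩
    3 * p + 1                                             ∎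
    where
    open ≤-Reasoning
    arith : ∀ p → 2 * p + suc p ≡ 3 * p + 1
    arith = solve-∀

  2^J*weight≤[3p+1]^J : ∀ J → 2 ^ J * weight J ≤ (3 * p + 1) ^ J
  2^J*weight≤[3p+1]^J zero    = ≤-refl
  2^J*weight≤[3p+1]^J (suc J) = begin
    2 * 2 ^ J * weight (suc J)           ≤⟨ *-monoʳ-≤ (2 * 2 ^ J) (weight-suc J) ⟩
    2 * 2 ^ J * (W₁ * weight J)          ≡⟨ shuffle 2 (2 ^ J) W₁ (weight J) ⟩
    (2 * W₁) * (2 ^ J * weight J)        ≤⟨ *-mono-≤ 2*∑2^𝟙≤3p+1 (2^J*weight≤[3p+1]^J J) ⟩
    (3 * p + 1) * (3 * p + 1) ^ J        ∎
    where
    open ≤-Reasoning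
    W₁ = ∑[ e < p ] (2 ^ 𝟙 (e + e <? p))
    shuffle : ∀ a b c d → a * b * (c * d) ≡ (a * c) * (b * d)
    shuffle = solve-∀

  fewCarries*2^[1+J]≤2^T*weight : ∀ J T → fewCarries J T * 2 ^ suc J ≤ 2 ^ T * weight J
  fewCarries*2^[1+J]≤2^T*weight J T = begin
    fewCarries J T * 2 ^ suc J
      ≡⟨ *-comm (fewCarries J T) _ ⟩
    2 ^ suc J * fewCarries J T
      ≡⟨ ∑-*ˡ (2 ^ suc J) (p ^ J) ⟨
    ∑[ r < p ^ J ] (2 ^ suc J * 𝟙 (carries J r r <? T))
      ≤⟨ ∑-mono-≤ (p ^ J) (λ r _ → markov r (carries J r r <? T)) ⟩
    ∑[ r < p ^ J ] (2 ^ T * 2 ^ noncarries J r)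
      ≡⟨ ∑-*ˡ (2 ^ T) (p ^ J) ⟩
    2 ^ T * weight J                                    ∎
    where
    open ≤-Reasoning
    markov : ∀ r (d : Dec (carries J r r < T)) → 2 ^ suc J * 𝟙 d ≤ 2 ^ T * 2 ^ noncarries J r
    markov r (no _)  = ≤-trans (≤-reflexive (*-zeroʳ (2 ^ suc J))) z≤n
    markov r (yes c<T) = begin
      2 ^ suc J * 1
        ≡⟨ *-identityʳ _ ⟩
      2 ^ suc J
        ≤⟨ ^-monoʳ-≤ 2 (subst (λ x → suc x ≤ T + noncarries J r) (carries+noncarries J r)
            (+-monoˡ-≤ (noncarries J r) c<T)) ⟩
      2 ^ (T + noncarries J r)
        ≡⟨ ^-distribˡ-+-* 2 T (noncarries J r) ⟩
      2 ^ T * 2 ^ noncarries J r   ∎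

  ∑-runs≤ : ∀ n U H → ∑[ m < n ] 𝟙 (p ^ U ≤? m %p^ U + p ^ H) ≤ suc (n /p^ U) * p ^ H
  ∑-runs≤ n U H = begin
    ∑< n run                                             ≤⟨ ∑-≤-periodic n (p ^ U) {{p^≢0 U}} periodic ⟩
    suc (n /p^ U) * ∑< (p ^ U) run                       ≤⟨ *-monoʳ-≤ (suc (n /p^ U)) one-period ⟩
    suc (n /p^ U) * p ^ H                                ∎
    where
    open ≤-Reasoning
    run : ℕ → ℕ
    run m = 𝟙 (p ^ U ≤? m %p^ U + p ^ H)
    periodic : ∀ m → run (p ^ U + m) ≡ run m
    periodic m = cong (λ r → 𝟙 (p ^ U ≤? r + p ^ H)) (%-remove-+ˡ {p ^ U} m {{p^≢0 U}} ∣-refl)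
    one-period : ∑< (p ^ U) run ≤ p ^ H
    one-period = begin
      ∑< (p ^ U) run
        ≡⟨ ∑-cong (p ^ U) (λ r r<p^U →
            cong (λ r′ → 𝟙 (p ^ U ≤? r′ + p ^ H)) (m<n⇒m%n≡m {{p^≢0 U}} r<p^U)) ⟩
      ∑[ r < p ^ U ] 𝟙 (p ^ U ≤? r + p ^ H)
        ≤⟨ ∑-𝟙-≤+ (p ^ U) (p ^ U) (p ^ H) ≤-refl ⟩
      p ^ U + p ^ H ∸ p ^ U
        ≡⟨ m+n∸m≡n (p ^ U) (p ^ H) ⟩
      p ^ H                                              ∎

  ∑-fewCarries≤ : ∀ n J T → ∑[ m < n ] 𝟙 (carries J m m <? T) ≤ suc (n /p^ J) * fewCarries J T
  ∑-fewCarries≤ n J T = ∑-≤-periodic n (p ^ J) {{p^≢0 J}} (λ m →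
    cong (λ c → 𝟙 (c <? T)) (∑-cong J (λ i i<J →
      cong (λ r → 𝟙 (p ^ suc i ≤? r + r)) (%-remove-+ˡ {p ^ J} m {{p^≢0 (suc i)}} (^-monoʳ-∣ p i<J)))))

  fewCarries-bound : ∀ a U → 2 * fewCarries (12 * a) (U + a) * 2 ^ a ≤ 2 ^ U * p ^ (12 * a)
  fewCarries-bound a U =
    *-cancelʳ-≤ _ _ (2 ^ a * 4 ^ J) {{m*n≢0 (2 ^ a) (4 ^ J) {{m^n≢0 2 a}} {{m^n≢0 4 J}}}} (begin
    2 * c * x * (x * 4 ^ J)
      ≡⟨ cong (λ z → 2 * c * x * (x * z)) (^-distribʳ-* 2 2 J) ⟩
    2 * c * x * (x * (y * y))
      ≡⟨ shuffle₁ c x y ⟩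
    c * (2 * y) * y * (x * x)
      ≤⟨ *-monoˡ-≤ (x * x) (*-monoˡ-≤ y (fewCarries*2^[1+J]≤2^T*weight J (U + a))) ⟩
    2 ^ (U + a) * weight J * y * (x * x)
      ≡⟨ shuffle₂ (2 ^ (U + a)) (weight J) y (x * x) ⟩
    2 ^ (U + a) * (x * x * (y * weight J))
      ≤⟨ *-monoʳ-≤ (2 ^ (U + a)) (*-monoʳ-≤ (x * x) (2^J*weight≤[3p+1]^J J)) ⟩
    2 ^ (U + a) * (x * x * (3 * p + 1) ^ J)
      ≡⟨ cong (λ z → 2 ^ (U + a) * (z * (3 * p + 1) ^ J)) (^-distribʳ-* 2 2 a) ⟨
    2 ^ (U + a) * (4 ^ a * (3 * p + 1) ^ J)
      ≤⟨ *-monoʳ-≤ (2 ^ (U + a)) (4^a*[3p+1]^[12a]≤[4p]^[12a] p a (nonTrivial⇒n>1 p)) ⟩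
    2 ^ (U + a) * (4 * p) ^ J
      ≡⟨ cong₂ _*_ (^-distribˡ-+-* 2 U a) (^-distribʳ-* 4 p J) ⟩
    2 ^ U * x * (4 ^ J * p ^ J)
      ≡⟨ shuffle₃ (2 ^ U) x (4 ^ J) (p ^ J) ⟩
    2 ^ U * p ^ J * (x * 4 ^ J)        ∎)
    where
    open ≤-Reasoning
    J = 12 * a
    c = fewCarries J (U + a)
    x = 2 ^ a
    y = 2 ^ J
    shuffle₁ : ∀ b x y → 2 * b * x * (x * (y * y)) ≡ b * (2 * y) * y * (x * x)
    shuffle₁ = solve-∀
    shuffle₂ : ∀ t w y z → t * w * y * z ≡ t * (z * (y * w))
    shuffle₂ = solve-∀
    shuffle₃ : ∀ u x f q → u * x * (f * q) ≡ u * q * (x * f)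
    shuffle₃ = solve-∀

-- The exceptional set below n

module Exceptional (n : ℕ) where

  ℓ H U : ℕ
  ℓ = ⌊log₂ n ⌋
  H = largest (λ h → 480 * (h * h) ≤? ℓ) ℓ
  U = 3 * H + 2

  -- The bases 2+ q ≤ 2^(H+1); the composite ones merely enlarge the exceptional set.
  #bases : ℕ
  #bases = 2 ^ suc H ∸ 1

  module AtBase (q : ℕ) where
    open Base (2+ q) public

    p a J T : ℕ
    p = 2+ q
    a = digits (p ^ 12) n
    J = 12 * a
    T = U + a

    longRun fewDoublingCarries exceptional : ℕ → ℕ
    longRun m            = 𝟙 (p ^ U ≤? m %p^ U + p ^ H)
    fewDoublingCarries m = 𝟙 (carries J m m <? T)
    exceptional m        = longRun m + fewDoublingCarries m

    n<p^J : n < p ^ J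
    n<p^J = subst (n <_) (^-*-assoc p 12 a)
      (n<Q^digits (≤-trans (nonTrivial⇒n>1 p) (m≤m*n p (p ^ 11) {{p^≢0 11}})) n)

    valuation-gap : Prime p → ∀ {m k} → exceptional m ≡ 0 → k ≤ p ^ H →
                    a + valuation p ((m + k) C m) ≤ valuation p ((2 * m) C m)
    valuation-gap p-prime {m} {k} unexceptional k≤p^H = begin
      a + valuation p ((m + k) C m)   ≤⟨ +-monoʳ-≤ a (valuation-C≤ p-prime {H = H} run k≤p^H) ⟩
      a + U                           ≡⟨ +-comm a U ⟩
      T                               ≤⟨ ≮⇒≥ (𝟙≡0⇒¬ (carries J m m <? T) (m+n≡0⇒n≡0 _ unexceptional)) ⟩
      carries J m m                   ≤⟨ carries≤valuation-C p-prime J m ⟩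
      valuation p ((2 * m) C m)       ∎
      where
      open ≤-Reasoning
      run : m %p^ U + p ^ H < p ^ U
      run = ≰⇒> (𝟙≡0⇒¬ (p ^ U ≤? m %p^ U + p ^ H) (m+n≡0⇒m≡0 _ unexceptional))

  badness : ℕ → ℕ
  badness m = ∑[ q < #bases ] AtBase.exceptional q m

  H-maximal : ∀ {h} → 480 * (h * h) ≤ ℓ → h ≤ H
  H-maximal {h} 480h²≤ℓ = ≤-largest (λ h → 480 * (h * h) ≤? ℓ) ℓ h≤ℓ 480h²≤ℓ
    where
    h≤h*h : ∀ h → h ≤ h * h
    h≤h*h zero    = z≤n
    h≤h*h (suc h) = m≤m*n (suc h) (suc h)
    h≤ℓ : h ≤ ℓ
    h≤ℓ = ≤-trans (h≤h*h h) (≤-trans (m≤n*m (h * h) 480) 480h²≤ℓ)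

  k≤2^H : ∀ {m k} → m ≤ n → 480 * (⌈log₂ k ⌉ * ⌈log₂ k ⌉) ≤ 1 * ⌊log₂ m ⌋ → k ≤ 2 ^ H
  k≤2^H {m} {k} m≤n k-small = ≤-trans (n≤2^⌈log₂n⌉ k) (^-monoʳ-≤ 2 (H-maximal {⌈log₂ k ⌉}
    (≤-trans k-small (≤-trans (≤-reflexive (*-identityˡ _)) (⌊log₂⌋-mono-≤ m≤n)))))

  badness≡0⇒InS : ∀ {m} → m ≤ n → badness m ≡ 0 → InS 1 480 1 12 m
  badness≡0⇒InS m≤n good k k-small 0 p-prime = contradiction p-prime ¬prime[0]
  badness≡0⇒InS m≤n good k k-small 1 p-prime = contradiction p-prime ¬prime[1]
  badness≡0⇒InS {m} m≤n good k k-small (2+ q) p-prime =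
    ν-mono (p ≤? 2 * k) , λ p≤2k → ν-gap (gap p≤2k)
    where
    open AtBase q

    gap : p ≤ 2 * k → a + valuation p ((m + k) C m) ≤ valuation p ((2 * m) C m)
    gap p≤2k = valuation-gap p-prime (∑≡0⇒≡0 {λ q → AtBase.exceptional q m} #bases good q q<#bases)
                             (≤-trans k≤2^H′ (^-monoˡ-≤ H (nonTrivial⇒n>1 p)))
      where
      k≤2^H′ = k≤2^H m≤n k-small
      q<#bases : q < #bases
      q<#bases = ∸-monoˡ-≤ 1 (≤-trans p≤2k (*-monoʳ-≤ 2 k≤2^H′))

    ν-mono : Dec (p ≤ 2 * k) → ν p ((m + k) C m) ≤ ν p ((2 * m) C m)
    ν-mono p≤2k? = subst₂ _≤_ (sym (ν≡valuation q ((m + k) C m))) (sym (ν≡valuation q ((2 * m) C m)))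
                          (valuation-mono p≤2k?)
      where
      valuation-mono : Dec (p ≤ 2 * k) → valuation p ((m + k) C m) ≤ valuation p ((2 * m) C m)
      valuation-mono (yes p≤2k) = m+n≤o⇒n≤o a (gap p≤2k)
      valuation-mono (no  p≰2k) =
        valuation-C-mono p-prime m k (subst (_< p) (cong (k +_) (+-identityʳ k)) (≰⇒> p≰2k))

    ν-gap : a + valuation p ((m + k) C m) ≤ valuation p ((2 * m) C m) →
            m ^ 1 ≤ p ^ (12 * (ν p ((2 * m) C m) ∸ ν p ((m + k) C m)))
    ν-gap gap = subst₂ (λ v₂ vₖ → m ^ 1 ≤ p ^ (12 * (v₂ ∸ vₖ)))
                       (sym (ν≡valuation q ((2 * m) C m))) (sym (ν≡valuation q ((m + k) C m))) (begin
      m ^ 1                ≡⟨ ^-identityʳ m ⟩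
      m                    ≤⟨ m≤n ⟩
      n                    <⟨ n<p^J ⟩
      p ^ (12 * a)         ≤⟨ ^-monoʳ-≤ p (*-monoʳ-≤ 12 (m+n≤o⇒m≤o∸n a gap)) ⟩
      p ^ (12 * (valuation p ((2 * m) C m) ∸ valuation p ((m + k) C m))) ∎)
      where open ≤-Reasoning

  H-satisfies : 480 * (H * H) ≤ ℓ
  H-satisfies = largest-satisfies (λ h → 480 * (h * h) ≤? ℓ) z≤n ℓ

  module Bounds (0<n : 0 < n) (3≤H : 3 ≤ H) where

    -- 2^K = 2^(H+1) · 2^H pays for the number of bases and for the factor 3t ≤ 2^H.
    K : ℕ
    K = suc H + H

    2^ℓ≤n : 2 ^ ℓ ≤ n
    2^ℓ≤n = 2^⌊log₂n⌋≤n 0<n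

    module _ (q : ℕ) (p≤2^[1+H] : 2+ q ≤ 2 ^ suc H) where
      open AtBase q

      p^e≤2^[[1+H]*e] : ∀ e → p ^ e ≤ 2 ^ (suc H * e)
      p^e≤2^[[1+H]*e] e = subst (p ^ e ≤_) (^-*-assoc 2 (suc H) e) (^-monoˡ-≤ e p≤2^[1+H])

      exceptional-count : ∑[ m < suc n ] exceptional m ≤ suc n /p^ U * p ^ H + p ^ H + 2 * fewCarries J T
      exceptional-count = begin
        ∑[ m < suc n ] exceptional m
          ≡⟨ ∑-distrib-+ {longRun} {fewDoublingCarries} (suc n) ⟩
        ∑< (suc n) longRun + ∑< (suc n) fewDoublingCarries
          ≤⟨ +-mono-≤ (∑-runs≤ (suc n) U H) (∑-fewCarries≤ (suc n) J T) ⟩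
        suc (suc n /p^ U) * p ^ H + suc (suc n /p^ J) * fewCarries J T
          ≤⟨ +-monoʳ-≤ (suc (suc n /p^ U) * p ^ H)
              (*-monoˡ-≤ (fewCarries J T) (s≤s [1+n]/p^J≤1)) ⟩
        suc (suc n /p^ U) * p ^ H + 2 * fewCarries J T
          ≡⟨ cong (_+ 2 * fewCarries J T) (+-comm (p ^ H) _) ⟩
        suc n /p^ U * p ^ H + p ^ H + 2 * fewCarries J T               ∎
        where
        open ≤-Reasoning
        [1+n]/p^J≤1 : suc n /p^ J ≤ 1
        [1+n]/p^J≤1 = ≤-trans (/-monoˡ-≤ (p ^ J) {{p^≢0 J}} n<p^J) (≤-reflexive (n/n≡1 (p ^ J) {{p^≢0 J}}))

      runs-bound : 2 ^ K * (suc n /p^ U * p ^ H) ≤ n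
      runs-bound = *-cancelˡ-≤ 2 (begin
        2 * (2 ^ K * (X * p ^ H))
          ≡⟨ shuffle (2 ^ K) X (p ^ H) ⟩
        2 ^ suc K * p ^ H * X
          ≤⟨ *-monoˡ-≤ X (*-monoˡ-≤ (p ^ H) (^-monoˡ-≤ (suc K) (nonTrivial⇒n>1 p))) ⟩
        p ^ suc K * p ^ H * X
          ≡⟨ cong (_* X) (trans (cong (p ^_) (sym U≡)) (^-distribˡ-+-* p (suc K) H)) ⟨
        p ^ U * X
          ≡⟨ *-comm (p ^ U) X ⟩
        X * p ^ U
          ≤⟨ m/n*n≤m (suc n) (p ^ U) {{p^≢0 U}} ⟩
        suc n
          ≤⟨ +-monoˡ-≤ n 0<n ⟩
        n + n
          ≡⟨ cong (n +_) (+-identityʳ n) ⟨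
        2 * n                              ∎)
        where
        open ≤-Reasoning
        X = suc n /p^ U
        shuffle : ∀ k x h → 2 * (k * (x * h)) ≡ 2 * k * h * x
        shuffle = solve-∀
        U≡ : suc K + H ≡ U
        U≡ = arith H
          where
          arith : ∀ h → suc (suc h + h) + h ≡ 3 * h + 2
          arith = solve-∀

      p^H-bound : 2 ^ K * p ^ H ≤ n
      p^H-bound = begin
        2 ^ K * p ^ H
          ≤⟨ *-monoʳ-≤ (2 ^ K) (p^e≤2^[[1+H]*e] H) ⟩
        2 ^ K * 2 ^ (suc H * H)
          ≡⟨ ^-distribˡ-+-* 2 K (suc H * H) ⟨
        2 ^ (K + suc H * H)
          ≤⟨ ^-monoʳ-≤ 2 (≤-trans (exponent H (≤-trans (s≤s z≤n) 3≤H)) H-satisfies) ⟩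
        2 ^ ℓ
          ≤⟨ 2^ℓ≤n ⟩
        n                                ∎
        where
        open ≤-Reasoning
        exponent : ∀ h → 1 ≤ h → suc h + h + suc h * h ≤ 480 * (h * h)
        exponent h 1≤h = begin
          suc h + h + suc h * h
            ≡⟨ expand h ⟩
          h * h + 3 * h + 1
            ≤⟨ +-mono-≤ (+-monoʳ-≤ (h * h) (*-monoʳ-≤ 3 (m≤m*n h h {{>-nonZero 1≤h}})))
                (*-mono-≤ 1≤h 1≤h) ⟩
          h * h + 3 * (h * h) + h * h
            ≡⟨ collect (h * h) ⟩
          5 * (h * h)
            ≤⟨ *-monoˡ-≤ (h * h) (≤ᵇ⇒≤ 5 480 tt) ⟩
          480 * (h * h)                  ∎
          where
          expand : ∀ h → suc h + h + suc h * h ≡ h * h + 3 * h + 1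
          expand = solve-∀
          collect : ∀ s → s + 3 * s + s ≡ 5 * s
          collect = solve-∀

      a-large : 40 * H < a + 40
      a-large = *-cancelʳ-< (suc H) (40 * H) (a + 40) (begin-strict
        40 * H * suc H                   ≡⟨ expand H ⟩
        40 * (H * H) + 40 * H            <⟨ +-monoˡ-< (40 * H) 40H²<[1+H]a ⟩
        suc H * a + 40 * H               ≤⟨ +-monoʳ-≤ (suc H * a) (*-monoʳ-≤ 40 (n≤1+n H)) ⟩
        suc H * a + 40 * suc H           ≡⟨ collect H a ⟩
        (a + 40) * suc H                 ∎)
        where
        open ≤-Reasoning
        expand : ∀ h → 40 * h * suc h ≡ 40 * (h * h) + 40 * h
        expand = solve-∀
        collect : ∀ h a → suc h * a + 40 * suc h ≡ (a + 40) * suc h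
        collect = solve-∀
        ℓ<[1+H]J : ℓ < suc H * J
        ℓ<[1+H]J = ≰⇒> λ [1+H]J≤ℓ → <⇒≱ (begin-strict
          2 ^ ℓ                          ≤⟨ 2^ℓ≤n ⟩
          n                              <⟨ n<p^J ⟩
          p ^ J                          ≤⟨ p^e≤2^[[1+H]*e] J ⟩
          2 ^ (suc H * J)                ∎) (^-monoʳ-≤ 2 [1+H]J≤ℓ)
        40H²<[1+H]a : 40 * (H * H) < suc H * a
        40H²<[1+H]a = *-cancelˡ-< 12 (40 * (H * H)) (suc H * a) (begin-strict
          12 * (40 * (H * H))            ≡⟨ *-assoc 12 40 (H * H) ⟨
          480 * (H * H)                  ≤⟨ H-satisfies ⟩
          ℓ                              <⟨ ℓ<[1+H]J ⟩
          suc H * (12 * a)               ≡⟨ *-comm (suc H) (12 * a) ⟩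
          12 * a * suc H                 ≡⟨ *-assoc 12 a (suc H) ⟩
          12 * (a * suc H)               ≡⟨ cong (12 *_) (*-comm a (suc H)) ⟩
          12 * (suc H * a)               ∎)

      p^J≤2^[[1+H]*12]*n : p ^ J ≤ 2 ^ (suc H * 12) * n
      p^J≤2^[[1+H]*12]*n = begin
        p ^ J                          ≡⟨ ^-*-assoc p 12 a ⟨
        (p ^ 12) ^ a                   ≤⟨ Q^digits≤Q*n (p ^ 12) 0<n ⟩
        p ^ 12 * n                     ≤⟨ *-monoˡ-≤ n (p^e≤2^[[1+H]*e] 12) ⟩
        2 ^ (suc H * 12) * n           ∎
        where open ≤-Reasoning

      fewCarries-count-bound : 2 ^ K * (2 * fewCarries J T) ≤ n
      fewCarries-count-bound = *-cancelʳ-≤ (2 ^ K * (2 * F)) n (2 ^ (40 * H)) {{m^n≢0 2 (40 * H)}} (begin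
        2 ^ K * (2 * F) * 2 ^ (40 * H)
          ≤⟨ *-monoʳ-≤ (2 ^ K * (2 * F)) (^-monoʳ-≤ 2 (<⇒≤ a-large)) ⟩
        2 ^ K * (2 * F) * 2 ^ (a + 40)
          ≡⟨ cong (2 ^ K * (2 * F) *_) (^-distribˡ-+-* 2 a 40) ⟩
        2 ^ K * (2 * F) * (2 ^ a * 2 ^ 40)
          ≡⟨ shuffle₁ (2 ^ K) F (2 ^ a) (2 ^ 40) ⟩
        2 ^ K * 2 ^ 40 * (2 * F * 2 ^ a)
          ≤⟨ *-monoʳ-≤ (2 ^ K * 2 ^ 40) (fewCarries-bound a U) ⟩
        2 ^ K * 2 ^ 40 * (2 ^ U * p ^ J)
          ≤⟨ *-monoʳ-≤ (2 ^ K * 2 ^ 40) (*-monoʳ-≤ (2 ^ U) p^J≤2^[[1+H]*12]*n) ⟩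
        2 ^ K * 2 ^ 40 * (2 ^ U * (2 ^ (suc H * 12) * n))
          ≡⟨ shuffle₂ (2 ^ K * 2 ^ 40) (2 ^ U) (2 ^ (suc H * 12)) n ⟩
        2 ^ K * 2 ^ 40 * (2 ^ U * 2 ^ (suc H * 12)) * n
          ≡⟨ cong (_* n) powers ⟨
        2 ^ (K + 40 + (U + suc H * 12)) * n
          ≤⟨ *-monoˡ-≤ n (^-monoʳ-≤ 2 (exponent H 3≤H)) ⟩
        2 ^ (40 * H) * n
          ≡⟨ *-comm (2 ^ (40 * H)) n ⟩
        n * 2 ^ (40 * H)                                 ∎)
        where
        open ≤-Reasoning
        F = fewCarries J T
        shuffle₁ : ∀ k f x y → k * (2 * f) * (x * y) ≡ k * y * (2 * f * x)
        shuffle₁ = solve-∀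
        shuffle₂ : ∀ c u s m → c * (u * (s * m)) ≡ c * (u * s) * m
        shuffle₂ = solve-∀
        powers : 2 ^ (K + 40 + (U + suc H * 12)) ≡ 2 ^ K * 2 ^ 40 * (2 ^ U * 2 ^ (suc H * 12))
        powers = trans (^-distribˡ-+-* 2 (K + 40) (U + suc H * 12))
                       (cong₂ _*_ (^-distribˡ-+-* 2 K 40) (^-distribˡ-+-* 2 U (suc H * 12)))
        exponent : ∀ h → 3 ≤ h → suc h + h + 40 + (3 * h + 2 + suc h * 12) ≤ 40 * h
        exponent h 3≤h = begin
          suc h + h + 40 + (3 * h + 2 + suc h * 12)  ≡⟨ expand h ⟩
          17 * h + 55                    ≤⟨ +-monoʳ-≤ (17 * h) (≤-trans (≤ᵇ⇒≤ 55 69 tt) (*-monoʳ-≤ 23 3≤h)) ⟩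
          17 * h + 23 * h                ≡⟨ collect h ⟩
          40 * h                         ∎
          where
          expand : ∀ h → suc h + h + 40 + (3 * h + 2 + suc h * 12) ≡ 17 * h + 55
          expand = solve-∀
          collect : ∀ h → 17 * h + 23 * h ≡ 40 * h
          collect = solve-∀

      exceptional-bound : ∀ {t} → 3 * t ≤ 2 ^ H → 2 ^ suc H * (3 * t * ∑[ m < suc n ] exceptional m) ≤ 3 * n
      exceptional-bound {t} 3t≤2^H = begin
        2 ^ suc H * (3 * t * E)
          ≤⟨ *-monoʳ-≤ (2 ^ suc H) (*-monoˡ-≤ E 3t≤2^H) ⟩
        2 ^ suc H * (2 ^ H * E)
          ≡⟨ trans (cong (_* E) (^-distribˡ-+-* 2 (suc H) H)) (*-assoc (2 ^ suc H) (2 ^ H) E) ⟨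
        2 ^ K * E
          ≤⟨ *-monoʳ-≤ (2 ^ K) exceptional-count ⟩
        2 ^ K * (X + p ^ H + 2 * F)
          ≡⟨ distrib (2 ^ K) X (p ^ H) (2 * F) ⟩
        2 ^ K * X + 2 ^ K * p ^ H + 2 ^ K * (2 * F)
          ≤⟨ +-mono-≤ (+-mono-≤ runs-bound p^H-bound) fewCarries-count-bound ⟩
        n + n + n
          ≡⟨ triple n ⟩
        3 * n                                        ∎
        where
        open ≤-Reasoning
        E = ∑[ m < suc n ] exceptional m
        X = suc n /p^ U * p ^ H
        F = fewCarries J T
        distrib : ∀ k x y z → k * (x + y + z) ≡ k * x + k * y + k * z
        distrib = solve-∀
        triple : ∀ n → n + n + n ≡ 3 * n
        triple = solve-∀

    badness-bound : ∀ {t} → 3 * t ≤ 2 ^ H → t * ∑[ m < suc n ] badness m ≤ n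
    badness-bound {t} 3t≤2^H = *-cancelˡ-≤ 3 (begin
      3 * (t * ∑[ m < suc n ] badness m)
        ≡⟨ *-assoc 3 t _ ⟨
      3 * t * ∑[ m < suc n ] badness m
        ≡⟨ cong (3 * t *_) (∑-comm (suc n) #bases exc) ⟩
      3 * t * ∑[ q < #bases ] ∑[ m < suc n ] exc m q
        ≡⟨ ∑-*ˡ (3 * t) #bases ⟨
      ∑[ q < #bases ] (3 * t * ∑[ m < suc n ] exc m q)
        ≤⟨ ∑-≤-mean #bases (3 * n) per-base ⟩
      3 * n                                                       ∎)
      where
      open ≤-Reasoning
      exc : ℕ → ℕ → ℕ
      exc m q = AtBase.exceptional q m
      per-base : ∀ q → q < #bases → #bases * (3 * t * ∑[ m < suc n ] exc m q) ≤ 3 * n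
      per-base q q<#bases = ≤-trans (*-monoˡ-≤ (3 * t * ∑[ m < suc n ] exc m q) (m∸n≤m (2 ^ suc H) 1))
                                    (exceptional-bound q p≤2^[1+H] {t} 3t≤2^H)
        where
        p≤2^[1+H] : 2+ q ≤ 2 ^ suc H
        p≤2^[1+H] = subst (_≤ 2 ^ suc H) (+-comm (suc q) 1) (m≤o∸n⇒m+n≤o (suc q) (m^n>0 2 (suc H)) q<#bases)

  t*∑badness≤n : ∀ t → 0 < n → t + 3 ≤ H → t * ∑[ m < suc n ] badness m ≤ n
  t*∑badness≤n t 0<n t+3≤H = Bounds.badness-bound 0<n (m+n≤o⇒n≤o t t+3≤H) {t} (begin
    3 * t
      ≤⟨ *-monoˡ-≤ t (n≤1+n 3) ⟩
    4 * t
      ≤⟨ *-monoʳ-≤ 4 (<⇒≤ (n<m^n (s≤s (s≤s z≤n)) t)) ⟩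
    4 * 2 ^ t
      ≡⟨ *-assoc 2 2 (2 ^ t) ⟩
    2 ^ (2 + t)
      ≤⟨ ^-monoʳ-≤ 2 (≤-trans (≤-reflexive (+-comm 2 t)) (≤-trans (+-monoʳ-≤ t (n≤1+n 2)) t+3≤H)) ⟩
    2 ^ H              ∎)
    where open ≤-Reasoning

  2^[480h²]≤n⇒h≤H : ∀ {h} → 2 ^ (480 * (h * h)) ≤ n → h ≤ H
  2^[480h²]≤n⇒h≤H {h} 2^[480h²]≤n =
    H-maximal (subst (_≤ ℓ) (⌊log₂[2^n]⌋≡n (480 * (h * h))) (⌊log₂⌋-mono-≤ 2^[480h²]≤n))

-- Density

select : {P : ℕ → Set} → U.Decidable P → ∀ n → Subset n
select P? zero    = []
select P? (suc n) = does (P? 0) ∷ select (P? ∘ suc) n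

select-sound : {P : ℕ → Set} (P? : U.Decidable P) → ∀ n (i : Fin n) → i ∈ select P? n → P (toℕ i)
select-sound P? (suc n) Fin.zero    i∈ with P? 0
... | yes P0 = P0
select-sound P? (suc n) Fin.zero    () | no _
select-sound P? (suc n) (Fin.suc i) (there i∈) = select-sound (P? ∘ suc) n i i∈

∣select∣ : {P : ℕ → Set} (P? : U.Decidable P) → ∀ n → ∣ select P? n ∣ ≡ ∑[ i < n ] 𝟙 (P? i)
∣select∣ P? zero    = refl
∣select∣ P? (suc n) with P? 0
... | yes _ = cong suc (∣select∣ (P? ∘ suc) n)
... | no  _ = ∣select∣ (P? ∘ suc) n

hasDensityOne : {P : ℕ → Set} (bad : ℕ → ℕ → ℕ) →
                (∀ {n m} → 0 < m → m ≤ n → bad n m ≡ 0 → P m) →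
                (∀ t → 1 ≤ t → Σ ℕ λ N → ∀ {n} → N ≤ n → t * ∑[ m < suc n ] bad n m ≤ n) →
                HasDensityOne P
hasDensityOne {P} bad bad≡0⇒P sparse t 1≤t = N , λ n N≤n →
  select (good? n) n , (λ i i∈ → bad≡0⇒P z<s (toℕ<n i) (select-sound (good? n) n i i∈)) , size n N≤n
  where
  N = proj₁ (sparse t 1≤t)
  good? : ∀ n → U.Decidable (λ i → bad n (suc i) ≡ 0)
  good? n i = bad n (suc i) ≟ 0
  size : ∀ n → N ≤ n → (t ∸ 1) * n ≤ t * ∣ select (good? n) n ∣
  size n N≤n = [t∸1]n≤ts 1≤t n≤S+total (proj₂ (sparse t 1≤t) N≤n)
    where
    open ≤-Reasoning
    total = ∑[ m < suc n ] bad n m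
    n≤S+total : n ≤ ∣ select (good? n) n ∣ + total
    n≤S+total = begin
      n
        ≡⟨ trans (∑-const n 1) (*-identityʳ n) ⟨
      ∑[ i < n ] 1
        ≤⟨ ∑-mono-≤ n (λ i _ → 1≤𝟙+ (bad n (suc i))) ⟩
      ∑[ i < n ] (𝟙 (good? n i) + bad n (suc i))
        ≡⟨ ∑-distrib-+ n ⟩
      ∑[ i < n ] 𝟙 (good? n i) + ∑[ i < n ] bad n (suc i)
        ≡⟨ cong (_+ ∑[ i < n ] bad n (suc i)) (∣select∣ (good? n) n) ⟨
      ∣ select (good? n) n ∣ + ∑[ i < n ] bad n (suc i)
        ≤⟨ +-monoʳ-≤ ∣ select (good? n) n ∣ (m≤n+m (∑[ i < n ] bad n (suc i)) (bad n 0)) ⟩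
      ∣ select (good? n) n ∣ + total                        ∎
      where
      1≤𝟙+ : ∀ x → 1 ≤ 𝟙 (x ≟ 0) + x
      1≤𝟙+ zero    = ≤-refl
      1≤𝟙+ (suc x) = s≤s z≤n
    [t∸1]n≤ts : ∀ {t n s b} → 1 ≤ t → n ≤ s + b → t * b ≤ n → (t ∸ 1) * n ≤ t * s
    [t∸1]n≤ts {suc t} {n} {s} {b} _ n≤s+b tb≤n = +-cancelʳ-≤ n (t * n) (suc t * s) (begin
      t * n + n                ≡⟨ +-comm (t * n) n ⟩
      suc t * n                ≤⟨ *-monoʳ-≤ (suc t) n≤s+b ⟩
      suc t * (s + b)          ≡⟨ *-distribˡ-+ (suc t) s b ⟩
      suc t * s + suc t * b    ≤⟨ +-monoʳ-≤ (suc t * s) tb≤n ⟩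
      suc t * s + n            ∎)

theorem2 : Σ ℕ λ a1 → Σ ℕ λ b1 → Σ ℕ λ a2 → Σ ℕ λ b2 →
    (1 ≤ a1) × (1 ≤ b1) × (1 ≤ a2) × (1 ≤ b2) ×
    HasDensityOne (InS a1 b1 a2 b2)
theorem2 = 1 , 480 , 1 , 12 , s≤s z≤n , s≤s z≤n , s≤s z≤n , s≤s z≤n ,
  hasDensityOne badness (λ {n} _ m≤n → badness≡0⇒InS n m≤n) sparse
  where
  open Exceptional using (badness; badness≡0⇒InS; t*∑badness≤n; 2^[480h²]≤n⇒h≤H)
  sparse : ∀ t → 1 ≤ t → Σ ℕ λ N → ∀ {n} → N ≤ n → t * ∑[ m < suc n ] badness n m ≤ n
  sparse t _ = N , λ {n} N≤n → t*∑badness≤n n t (<-≤-trans (m^n>0 2 e) N≤n) (2^[480h²]≤n⇒h≤H n {t + 3} N≤n)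
    where
    e = 480 * ((t + 3) * (t + 3))
    N = 2 ^ e
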